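{- Consider the $k$-taxi problem on the complete $k$-ary rooted tree of depth $d$ with unit edge lengths, with DoubleCoverage as the online algorithm. Suppose the current situation is a $j$-match around $(x,y)$ and let $h$ be the height of $y$. Then there exists a request sequence on which DoubleCoverage incurs cost $2\binom{j+h}{h}-1$, the offline algorithm incurs cost $0$, and the resulting situation differs from the original one only in that there is one online server less at $x$ and instead there is an online server at $y$.
   Context: $k$-taxi problem: $k$ servers; requests $(s_t,d_t)$ arrive online; to serve one, a server is moved to $s_t$ (if none is there), paying the distance traveled, and then a server at $s_t$ is relocated to $d_t$ at no cost. DoubleCoverage (DC, the online algorithm): to bring a server to requested vertex $s$, all unobstructed servers (no other server on their path to $s$; among co-located servers only one counts) move toward $s$ at equal speed until one reaches $s$, a server becoming obstructed stops; then a server is relocated from $s_t$ to $d_t$. The height of a vertex is its distance to the leaves below it (all leaves are at depth $d$). A situation is a pair consisting of the configuration of DC's $k$ servers (online servers) and the configuration of $k$ servers of an offline algorithm (offline servers). A situation is a $j$-match around $(x,y)$, where $y$ is a child of $x$, if: the locations of $j$ online servers coincide with those of $j$ offline servers; among the remaining online servers at least one is at $x$ and none is in the subtree strictly below $x$; and among the remaining offline servers at least one is at $y$. -}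

module Defs where

open import Data.Bool using (Bool; true; false; if_then_else_; _∧_; _∨_; not)
open import Data.Nat using (ℕ; zero; suc; _+_; _*_; _∸_; _≤_; _<ᵇ_; _≡ᵇ_)
open import Data.Fin as Fin using (Fin; toℕ)
open import Data.List as List using (List; []; _∷_; _++_; length; take; allFin)
open import Data.Bool.ListAction using (all)
open import Data.Nat.ListAction as NL using ()
open import Data.List.Properties using (≡-dec)
open import Data.List.Relation.Unary.Any using (Any)
open import Data.Vec as Vec using (Vec; lookup; tabulate; _[_]≔_; toList; zipWith)
open import Data.Vec.Relation.Unary.All as VAll using ()
open import Data.Product using (Σ; ∃; ∃-syntax; _×_; _,_; proj₁; proj₂)
open import Relation.Nullary using (¬_)
open import Relation.Nullary.Decidable using (isYes)
open import Relation.Binary.PropositionalEquality using (_≡_; _≢_)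
open import Data.List.Relation.Binary.Permutation.Propositional using (_↭_)
open import Data.List.Membership.Propositional using (_∈_)
open import Data.List.Relation.Unary.All using (All)

-- A vertex is the path from the root: a list of child indices (Fin k),
-- root first, of length ≤ d.  The root is [], the children of p are
-- p ++ [ a ] for a : Fin k.  Leaves are the paths of length exactly d.

Path : ℕ → Set
Path k = List (Fin k)

ValidVertex : (k d : ℕ) → Path k → Set
ValidVertex k d p = length p ≤ d

IsChild : {k : ℕ} → Path k → Path k → Set
IsChild {k} x y = ∃[ a ] (y ≡ x ++ (a ∷ []))

StrictlyBelow : {k : ℕ} → Path k → Path k → Set
StrictlyBelow {k} x v = ∃[ a ] ∃[ t ] (v ≡ x ++ (a ∷ t))

-- height of a vertex: distance to the leaves below it
height : {k : ℕ} → ℕ → Path k → ℕ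
height d p = d ∸ length p

_==ₚ_ : {k : ℕ} → Path k → Path k → Bool
p ==ₚ q = isYes (≡-dec Fin._≟_ p q)

-- length of the longest common prefix (depth of the lowest common ancestor)
lcpLen : {k : ℕ} → Path k → Path k → ℕ
lcpLen (a ∷ u) (b ∷ v) = if isYes (a Fin.≟ b) then suc (lcpLen u v) else 0
lcpLen _ _ = 0

dist : {k : ℕ} → Path k → Path k → ℕ
dist u v = (length u ∸ lcpLen u v) + (length v ∸ lcpLen u v)

onPath : {k : ℕ} → Path k → Path k → Path k → Bool
onPath p v s = (dist p v + dist v s) ≡ᵇ dist p s

-- the vertex one edge from p towards s (assumes p ≠ s)
stepToward : {k : ℕ} → Path k → Path k → Path k
stepToward p s =
  if ((take (length p) s ==ₚ p) ∧ (length p <ᵇ length s))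
  then take (suc (length p)) s
  else take (length p ∸ 1) p

-- Configurations of k servers (servers labelled by Fin k; all statements
-- about situations are up to relabelling, i.e. about multisets).

Config : ℕ → Set
Config k = Vec (Path k) k

ValidConfig : (k d : ℕ) → Config k → Set
ValidConfig k d c = VAll.All (ValidVertex k d) c

Occupied : {k : ℕ} → Config k → Path k → Set
Occupied c s = ∃[ i ] (lookup c i ≡ s)

-- Server i is unobstructed iff every other
-- server j lying on the path from server i to s is co-located with i and has
-- a larger label (among co-located servers only the one with least label counts).
unobstructed : {k : ℕ} → Config k → Path k → Fin k → Bool
unobstructed {k} c s i = all ok (allFin k)
  where
  ok : Fin k → Bool
  ok j = isYes (j Fin.≟ i)
       ∨ not (onPath (lookup c i) (lookup c j) s)
       ∨ ((lookup c j ==ₚ lookup c i) ∧ (toℕ i <ᵇ toℕ j))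

-- one unit of time: every unobstructed server moves one edge towards s
dcStepConfig : {k : ℕ} → Config k → Path k → Config k
dcStepConfig c s = tabulate λ i →
  if unobstructed c s i then stepToward (lookup c i) s else lookup c i

dcStepCost : {k : ℕ} → Config k → Path k → ℕ
dcStepCost {k} c s =
  NL.sum (List.map (λ i → if unobstructed c s i then 1 else 0) (allFin k))

data DCBring {k : ℕ} : Config k → Path k → Config k → ℕ → Set where
  here : ∀ {c s} → Occupied c s → DCBring c s c 0
  step : ∀ {c s c' m} → ¬ Occupied c s →
         DCBring (dcStepConfig c s) s c' m →
         DCBring c s c' (dcStepCost c s + m)

Request : ℕ → Set
Request k = Path k × Path k

-- DC serves a request (s , t): bring a server to s, then relocate a server at s to t
DCServe : {k : ℕ} → Config k → Request k → Config k → ℕ → Set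
DCServe c (s , t) c' m =
  ∃[ c₁ ] (DCBring c s c₁ m × ∃[ i ] (lookup c₁ i ≡ s × c' ≡ c₁ [ i ]≔ t))

moveCost : {k : ℕ} → Config k → Config k → ℕ
moveCost c c' = Vec.sum (zipWith dist c c')

-- a general offline algorithm serving (s , t): move its servers to any
-- configuration c₁ (paying the distance travelled) with a server at s,
-- then relocate a server at s to t for free
OffServe : {k : ℕ} → Config k → Request k → Config k → ℕ → Set
OffServe c (s , t) c' m =
  ∃[ c₁ ] (m ≡ moveCost c c₁ × ∃[ i ] (lookup c₁ i ≡ s × c' ≡ c₁ [ i ]≔ t))

data Run {k : ℕ} : Config k → Config k → List (Request k) →
                   Config k → Config k → ℕ → ℕ → Set where
  done : ∀ {on off} → Run on off [] on off 0 0
  serve : ∀ {on off r rs on₁ off₁ on' off' m₁ m₁' m m'} →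
          DCServe on r on₁ m₁ → OffServe off r off₁ m₁' →
          Run on₁ off₁ rs on' off' m m' →
          Run on off (r ∷ rs) on' off' (m₁ + m) (m₁' + m')

ValidRequest : (k d : ℕ) → Request k → Set
ValidRequest k d (s , t) = ValidVertex k d s × ValidVertex k d t

JMatch : {k : ℕ} → ℕ → Path k → Path k → Config k → Config k → Set
JMatch {k} j x y on off =
  ∃[ M ] ∃[ Ron ] ∃[ Roff ]
    ( length M ≡ j
    × toList on ↭ M ++ Ron
    × toList off ↭ M ++ Roff
    × x ∈ Ron
    × All (λ v → ¬ StrictlyBelow x v) Ron
    × y ∈ Roff )

-- Induction on the height h of y; let j be the size of the match.  First every matched
-- pair of servers is walked, at no cost to either algorithm, onto j distinct children of
-- y (onto x when y is a leaf).  A request at y then moves, under DoubleCoverage, exactly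
-- the servers on those children and the least-labelled server at x: one step brings
-- j + 1 servers to y for cost j + 1, while the offline algorithm already serves it.  For
-- the i-th of these children z (i = 1, …, j) the situation is now an i-match around (y, z)
-- of height h - 1, which the induction hypothesis resolves by sending one online server
-- from y down to z.  Walking the matched pairs back restores the match, and Pascal's rule
-- (a hockey-stick sum) gives  j + 1 + Σᵢ (2·C(i + h - 1, h - 1) - 1) = 2·C(j + h, h) - 1.

module Submission where

open import Defs
open import Data.Bool using (Bool; true; false; if_then_else_; _∧_; _∨_; not; T)
open import Data.Bool.ListAction using (all)
open import Data.Bool.Properties using (∧-zeroʳ)
open import Data.Empty using (⊥-elim)
open import Data.Fin as Fin using (Fin; toℕ)
open import Data.Fin.Properties using (toℕ-injective)
open import Data.List as List using (List; []; _∷_; _++_; _∷ʳ_; _∷ʳ′_; length; take; allFin; replicate)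
open import Data.List.Membership.Propositional using (_∈_; _∉_)
open import Data.List.Membership.Propositional.Properties using (∈-allFin; ∈-++⁻; ∈-∃++; ∈-++⁺ʳ)
open import Data.List.Properties
  using (≡-dec; length-++; ++-assoc; ∷ʳ-injective; take-all; tabulate-cong; map-tabulate; map-++;
         map-id-local; length-map; length-take; length-tabulate; length-replicate)
open import Data.List.Relation.Binary.Permutation.Propositional
  using (_↭_; ↭⇒↭ₛ; module PermutationReasoning; ↭-refl; ↭-sym; ↭-trans; prep; swap)
open import Data.List.Relation.Binary.Permutation.Propositional.Properties
  using (All-resp-↭; ↭-length; drop-∷; shift; shifts; ++⁺ʳ; ++⁺ˡ; ∈-resp-↭; map⁺)
open import Data.List.Relation.Binary.Permutation.Setoid.Properties using (Unique-resp-↭)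
open import Data.List.Relation.Unary.All as All using (All; []; _∷_)
open import Data.List.Relation.Unary.All.Properties as All using (++⁺; replicate⁺)
open import Data.List.Relation.Unary.Any using (here; there)
open import Data.List.Relation.Unary.Unique.Propositional using (Unique; [])
open import Data.List.Relation.Unary.Unique.Propositional.Properties as Unique using (Unique[x∷xs]⇒x∉xs)
open import Data.Nat
  using (ℕ; zero; suc; pred; _⊓_; _+_; _*_; _∸_; _≤_; _<_; z≤n; s≤s; s≤s⁻¹; _<ᵇ_; _≡ᵇ_)
open import Data.Nat.Combinatorics using (_C_; nCn≡1; nCk+nC[k+1]≡[n+1]C[k+1])
open import Data.Nat.ListAction using (sum)
open import Data.Nat.ListAction.Properties using (sum-++; sum-↭)
open import Data.Nat.Properties
open import Algebra.Properties.CommutativeSemigroup +-commutativeSemigroup using (interchange)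
open import Data.Nat.Solver using (module +-*-Solver)
open import Data.Product using (∃-syntax; _×_; _,_; proj₁; proj₂)
open import Data.Sum using (_⊎_; inj₁; inj₂; [_,_]′)
open import Data.Vec as Vec using (Vec; lookup; toList; _[_]≔_)
open import Data.Vec.Membership.Propositional.Properties using (∈-toList⁺; ∈-lookup)
open import Data.Vec.Properties as Vec
  using (lookup∘update; lookup∘update′; tabulate-∘; tabulate∘lookup; toList-map;
         lookup-map; []≔-lookup; length-toList)
import Data.Vec.Relation.Unary.All.Properties as VAll
open import Function using (_$_; id; _∘_; case_of_)
open import Relation.Binary.Definitions using (DecidableEquality)
open import Relation.Binary.PropositionalEquality
open import Relation.Nullary using (¬_; Dec; yes; no)
open import Relation.Nullary.Decidable using (isYes)


isYes-≡true : ∀ {A : Set} (a? : Dec A) → A → isYes a? ≡ true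
isYes-≡true (yes _) _ = refl
isYes-≡true (no ¬a) a = ⊥-elim (¬a a)

isYes-≡false : ∀ {A : Set} (a? : Dec A) → ¬ A → isYes a? ≡ false
isYes-≡false (yes a) ¬a = ⊥-elim (¬a a)
isYes-≡false (no _) _ = refl

<⇒<ᵇ≡true : ∀ {m n} → m < n → (m <ᵇ n) ≡ true
<⇒<ᵇ≡true {zero} (s≤s _) = refl
<⇒<ᵇ≡true {suc m} (s≤s m<n) = <⇒<ᵇ≡true m<n

≥⇒<ᵇ≡false : ∀ {m n} → n ≤ m → (m <ᵇ n) ≡ false
≥⇒<ᵇ≡false z≤n = refl
≥⇒<ᵇ≡false (s≤s n≤m) = ≥⇒<ᵇ≡false n≤m

≡ᵇ-refl : ∀ m → (m ≡ᵇ m) ≡ true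
≡ᵇ-refl zero = refl
≡ᵇ-refl (suc m) = ≡ᵇ-refl m

≡ᵇ≡true⇒≡ : ∀ m n → (m ≡ᵇ n) ≡ true → m ≡ n
≡ᵇ≡true⇒≡ m n e = ≡ᵇ⇒≡ m n (subst T (sym e) _)

all-≡true : ∀ {A : Set} (p : A → Bool) xs → (∀ x → p x ≡ true) → all p xs ≡ true
all-≡true p [] _ = refl
all-≡true p (x ∷ xs) h rewrite h x = all-≡true p xs h

all-≡false : ∀ {A : Set} (p : A → Bool) {x} xs → x ∈ xs → p x ≡ false → all p xs ≡ false
all-≡false p (y ∷ xs) (here refl) px rewrite px = refl
all-≡false p (y ∷ xs) (there x∈xs) px rewrite all-≡false p xs x∈xs px = ∧-zeroʳ (p y)

length-∷ʳ : {A : Set} (x : List A) (a : A) → length (x ∷ʳ a) ≡ suc (length x)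
length-∷ʳ [] a = refl
length-∷ʳ (b ∷ x) a = cong suc (length-∷ʳ x a)

take-length-++ : {A : Set} (x w : List A) → take (length x) (x ++ w) ≡ x
take-length-++ [] w = refl
take-length-++ (a ∷ x) w = cong (a ∷_) (take-length-++ x w)

map-All-≡-replicate : ∀ {A B : Set} {f : A → B} {b} {xs} →
  All (λ x → f x ≡ b) xs → List.map f xs ≡ replicate (length xs) b
map-All-≡-replicate [] = refl
map-All-≡-replicate (fx≡b ∷ fxs≡b) = cong₂ _∷_ fx≡b (map-All-≡-replicate fxs≡b)

no-repeat-in-Unique : ∀ {A : Set} {Z Q rest : List A} {v} →
  Unique Z → v ∉ Q → v ∈ rest → ¬ (v ∷ rest ↭ Z ++ Q)
no-repeat-in-Unique {Z = Z} {Q} {rest} {v} uZ v∉Q v∈rest v∷rest↭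
  with ∈-++⁻ Z (∈-resp-↭ v∷rest↭ (here refl))
... | inj₂ v∈Q = v∉Q v∈Q
... | inj₁ v∈Z with ∈-∃++ v∈Z
... | A , B , refl = [ v∉A++B , v∉Q ]′ (∈-++⁻ (A ++ B) (∈-resp-↭ rest↭ v∈rest))
  where
  Z↭ : A ++ v ∷ B ↭ v ∷ A ++ B
  Z↭ = shift v A B
  v∉A++B : v ∉ A ++ B
  v∉A++B = Unique[x∷xs]⇒x∉xs (Unique-resp-↭ (setoid _) (↭⇒↭ₛ Z↭) uZ)
  rest↭ : rest ↭ (A ++ B) ++ Q
  rest↭ = drop-∷ (↭-trans v∷rest↭ (++⁺ʳ Q Z↭))

module _ {A : Set} where

  others : ∀ {n} → Vec A n → Fin n → List A
  others (_ Vec.∷ c) Fin.zero = toList c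
  others (p Vec.∷ c) (Fin.suc i) = p ∷ others c i

  toList↭lookup∷others : ∀ {n} (c : Vec A n) i → toList c ↭ lookup c i ∷ others c i
  toList↭lookup∷others (_ Vec.∷ _) Fin.zero = ↭-refl
  toList↭lookup∷others (p Vec.∷ c) (Fin.suc i) =
    ↭-trans (prep p (toList↭lookup∷others c i)) (swap p _ ↭-refl)

  toList-[]≔↭∷others : ∀ {n} (c : Vec A n) i t → toList (c [ i ]≔ t) ↭ t ∷ others c i
  toList-[]≔↭∷others (_ Vec.∷ _) Fin.zero t = ↭-refl
  toList-[]≔↭∷others (p Vec.∷ c) (Fin.suc i) t =
    ↭-trans (prep p (toList-[]≔↭∷others c i t)) (swap p t ↭-refl)

  lookup∈others : ∀ {n} (c : Vec A n) {i j} → j ≢ i → lookup c j ∈ others c i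
  lookup∈others (_ Vec.∷ c) {Fin.zero} {Fin.zero} j≢i = ⊥-elim (j≢i refl)
  lookup∈others (_ Vec.∷ c) {Fin.zero} {Fin.suc j} _ = ∈-toList⁺ (∈-lookup j c)
  lookup∈others (_ Vec.∷ c) {Fin.suc i} {Fin.zero} _ = here refl
  lookup∈others (_ Vec.∷ c) {Fin.suc i} {Fin.suc j} j≢i = there (lookup∈others c (j≢i ∘ cong Fin.suc))

  ∈-toList⇒lookup : ∀ {n} (c : Vec A n) {v} → v ∈ toList c → ∃[ i ] (lookup c i ≡ v)
  ∈-toList⇒lookup (p Vec.∷ c) (here refl) = Fin.zero , refl
  ∈-toList⇒lookup (p Vec.∷ c) (there v∈c) with ∈-toList⇒lookup c v∈c
  ... | i , e = Fin.suc i , e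

  toList-[]≔↭ : ∀ {n} (c : Vec A n) i {L} t →
    toList c ↭ lookup c i ∷ L → toList (c [ i ]≔ t) ↭ t ∷ L
  toList-[]≔↭ c i t c↭ = ↭-trans (toList-[]≔↭∷others c i t)
    (prep t (drop-∷ (↭-trans (↭-sym (toList↭lookup∷others c i)) c↭)))

  toList-replace : ∀ {n} (c : Vec A n) {v L} → toList c ↭ v ∷ L →
                   ∃[ i ] (lookup c i ≡ v × ∀ t → toList (c [ i ]≔ t) ↭ t ∷ L)
  toList-replace c c↭ with ∈-toList⇒lookup c (∈-resp-↭ (↭-sym c↭) (here refl))
  ... | i , ci≡v =
    i , ci≡v , λ t → toList-[]≔↭ c i t (subst (λ u → toList c ↭ u ∷ _) (sym ci≡v) c↭)

  least-index : DecidableEquality A → ∀ {n} (c : Vec A n) {v} → v ∈ toList c →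
                ∃[ i ] (lookup c i ≡ v × ∀ j → lookup c j ≡ v → toℕ i ≤ toℕ j)
  least-index _≟_ (p Vec.∷ c) {v} v∈c with p ≟ v
  ... | yes p≡v = Fin.zero , p≡v , λ _ _ → z≤n
  ... | no p≢v with v∈c
  ...   | here v≡p = ⊥-elim (p≢v (sym v≡p))
  ...   | there v∈c′ with least-index _≟_ c v∈c′
  ...     | i , ci≡v , least = Fin.suc i , ci≡v , λ where
              Fin.zero p≡v → ⊥-elim (p≢v p≡v)
              (Fin.suc j) cj≡v → s≤s (least j cj≡v)

iverson : Bool → ℕ
iverson b = if b then 1 else 0

sum-tabulate-+ : ∀ {n} (f g : Fin n → ℕ) →
  sum (List.tabulate (λ i → f i + g i)) ≡ sum (List.tabulate f) + sum (List.tabulate g)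
sum-tabulate-+ {zero} f g = refl
sum-tabulate-+ {suc n} f g rewrite sum-tabulate-+ (f ∘ Fin.suc) (g ∘ Fin.suc) =
  interchange (f Fin.zero) (g Fin.zero) (sum (List.tabulate (f ∘ Fin.suc))) (sum (List.tabulate (g ∘ Fin.suc)))

sum-tabulate-≟ : ∀ {n} (s : Fin n) → sum (List.tabulate (λ i → iverson (isYes (i Fin.≟ s)))) ≡ 1
sum-tabulate-≟ {suc n} Fin.zero = cong suc (sum-tabulate-zero n)
  where
  sum-tabulate-zero : ∀ m → sum (List.tabulate {n = m} (λ _ → 0)) ≡ 0
  sum-tabulate-zero zero = refl
  sum-tabulate-zero (suc m) = sum-tabulate-zero m
sum-tabulate-≟ {suc n} (Fin.suc s) =
  trans (cong sum (tabulate-cong {n = n} suc≟suc)) (sum-tabulate-≟ s)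
  where
  suc≟suc : ∀ i → iverson (isYes (Fin.suc i Fin.≟ Fin.suc s)) ≡ iverson (isYes (i Fin.≟ s))
  suc≟suc i with i Fin.≟ s
  ... | yes _ = refl
  ... | no _ = refl

sum-tabulate-lookup : ∀ {A : Set} {n} (F : A → ℕ) (c : Vec A n) →
  sum (List.tabulate (F ∘ lookup c)) ≡ sum (List.map F (toList c))
sum-tabulate-lookup F Vec.[] = refl
sum-tabulate-lookup F (p Vec.∷ c) = cong (F p +_) (sum-tabulate-lookup F c)

sum-map-All-≡ : ∀ {A : Set} (F : A → ℕ) {m} {xs} →
  All (λ x → F x ≡ m) xs → sum (List.map F xs) ≡ length xs * m
sum-map-All-≡ F [] = refl
sum-map-All-≡ F (Fx≡m ∷ Fxs≡m) = cong₂ _+_ Fx≡m (sum-map-All-≡ F Fxs≡m)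

module _ {k : ℕ} where

  lcpLen-∷-≡ : (a : Fin k) (u v : Path k) → lcpLen (a ∷ u) (a ∷ v) ≡ suc (lcpLen u v)
  lcpLen-∷-≡ a u v rewrite isYes-≡true (a Fin.≟ a) refl = refl

  lcpLen-refl : (u : Path k) → lcpLen u u ≡ length u
  lcpLen-refl [] = refl
  lcpLen-refl (a ∷ u) = trans (lcpLen-∷-≡ a u u) (cong suc (lcpLen-refl u))

  lcpLen-++ʳ : (x w : Path k) → lcpLen x (x ++ w) ≡ length x
  lcpLen-++ʳ [] w = refl
  lcpLen-++ʳ (a ∷ x) w = trans (lcpLen-∷-≡ a x (x ++ w)) (cong suc (lcpLen-++ʳ x w))

  lcpLen-++ˡ : (x w : Path k) → lcpLen (x ++ w) x ≡ length x
  lcpLen-++ˡ [] [] = refl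
  lcpLen-++ˡ [] (_ ∷ _) = refl
  lcpLen-++ˡ (a ∷ x) w = trans (lcpLen-∷-≡ a (x ++ w) x) (cong suc (lcpLen-++ˡ x w))

  lcpLen≤lengthʳ : (u v : Path k) → lcpLen u v ≤ length v
  lcpLen≤lengthʳ [] v = z≤n
  lcpLen≤lengthʳ (a ∷ u) [] = z≤n
  lcpLen≤lengthʳ (a ∷ u) (b ∷ v) with a Fin.≟ b
  ... | yes refl = s≤s (lcpLen≤lengthʳ u v)
  ... | no _ = z≤n

  lcpLen-full⇒≡ : (u v : Path k) → length u ≤ lcpLen u v → length v ≤ lcpLen u v → u ≡ v
  lcpLen-full⇒≡ [] [] _ _ = refl
  lcpLen-full⇒≡ (a ∷ u) (b ∷ v) p q with a Fin.≟ b
  ... | yes refl = cong (a ∷_) (lcpLen-full⇒≡ u v (s≤s⁻¹ p) (s≤s⁻¹ q))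

  dist-refl : (u : Path k) → dist u u ≡ 0
  dist-refl u rewrite lcpLen-refl u | n∸n≡0 (length u) = refl

  dist≡0⇒≡ : (u v : Path k) → dist u v ≡ 0 → u ≡ v
  dist≡0⇒≡ u v e = lcpLen-full⇒≡ u v
    (m∸n≡0⇒m≤n (m+n≡0⇒m≡0 _ e)) (m∸n≡0⇒m≤n (m+n≡0⇒n≡0 (length u ∸ lcpLen u v) e))

  dist-child : (x : Path k) (a : Fin k) → dist x (x ∷ʳ a) ≡ 1
  dist-child x a rewrite lcpLen-++ʳ x (a ∷ []) | length-∷ʳ x a | n∸n≡0 (length x)
    | m+n∸n≡m 1 (length x) = refl

  dist-parent : (x : Path k) (a : Fin k) → dist (x ∷ʳ a) x ≡ 1
  dist-parent x a rewrite lcpLen-++ˡ x (a ∷ []) | length-∷ʳ x a | n∸n≡0 (length x)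
    | m+n∸n≡m 1 (length x) = refl

  lcpLen-∷ʳ-outside : (x p : Path k) (a : Fin k) → ¬ StrictlyBelow x p → lcpLen p (x ∷ʳ a) ≡ lcpLen p x
  lcpLen-∷ʳ-outside [] [] a _ = refl
  lcpLen-∷ʳ-outside [] (b ∷ p) a p∉ = ⊥-elim (p∉ (b , p , refl))
  lcpLen-∷ʳ-outside (c ∷ x) [] a _ = refl
  lcpLen-∷ʳ-outside (c ∷ x) (b ∷ p) a p∉ with b Fin.≟ c
  ... | yes refl = cong suc (lcpLen-∷ʳ-outside x p a λ { (e , t , eq) → p∉ (e , t , cong (b ∷_) eq) })
  ... | no _ = refl

  dist-∷ʳ-outside : (x p : Path k) (a : Fin k) → ¬ StrictlyBelow x p → dist p (x ∷ʳ a) ≡ dist p x + 1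
  dist-∷ʳ-outside x p a p∉ rewrite lcpLen-∷ʳ-outside x p a p∉ | length-∷ʳ x a =
    trans (cong (length p ∸ l +_) (trans (+-∸-assoc 1 (lcpLen≤lengthʳ p x)) (+-comm 1 (length x ∸ l))))
          (sym (+-assoc (length p ∸ l) (length x ∸ l) 1))
    where
    l : ℕ
    l = lcpLen p x

  ==ₚ-refl : (x : Path k) → (x ==ₚ x) ≡ true
  ==ₚ-refl x = isYes-≡true (≡-dec Fin._≟_ x x) refl

  ==ₚ-≢ : {x y : Path k} → x ≢ y → (x ==ₚ y) ≡ false
  ==ₚ-≢ {x} {y} = isYes-≡false (≡-dec Fin._≟_ x y)

  stepToward-child : (x : Path k) (a : Fin k) → stepToward x (x ∷ʳ a) ≡ x ∷ʳ a
  stepToward-child x a rewrite take-length-++ x (a ∷ []) | ==ₚ-refl x | length-∷ʳ x a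
    | <⇒<ᵇ≡true (n<1+n (length x)) = take-all _ (x ∷ʳ a) (≤-reflexive (length-∷ʳ x a))

  stepToward-parent : (y : Path k) (b : Fin k) → stepToward (y ∷ʳ b) y ≡ y
  stepToward-parent y b rewrite length-∷ʳ y b | ≥⇒<ᵇ≡false (n≤1+n (length y))
    | ∧-zeroʳ (take (suc (length y)) y ==ₚ (y ∷ʳ b)) = take-length-++ y (b ∷ [])

  onPath-self : (p s : Path k) → onPath p p s ≡ true
  onPath-self p s rewrite dist-refl p = ≡ᵇ-refl (dist p s)

  onPath-adjacent : (p v s : Path k) → dist p s ≡ 1 → onPath p v s ≡ true → v ≡ p ⊎ v ≡ s
  onPath-adjacent p v s d≡1 on with dist p v in e
  ... | zero = inj₁ (sym (dist≡0⇒≡ p v e))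
  ... | suc n =
    inj₂ (dist≡0⇒≡ v s (m+n≡0⇒n≡0 n (suc-injective (trans (≡ᵇ≡true⇒≡ _ _ on) d≡1))))

  onPath-parent : (x p : Path k) (a : Fin k) → ¬ StrictlyBelow x p → onPath p x (x ∷ʳ a) ≡ true
  onPath-parent x p a p∉ rewrite dist-child x a | dist-∷ʳ-outside x p a p∉ = ≡ᵇ-refl (dist p x + 1)

  StrictlyBelow-∷ʳ : (x : Path k) (a : Fin k) → StrictlyBelow x (x ∷ʳ a)
  StrictlyBelow-∷ʳ x a = a , [] , refl

  grandchild⇒StrictlyBelow : (x v : Path k) (a : Fin k) → IsChild (x ∷ʳ a) v → StrictlyBelow x v
  grandchild⇒StrictlyBelow x v a (b , refl) = a , b ∷ [] , ++-assoc x (a ∷ []) (b ∷ [])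

  StrictlyBelow-∷ʳ⇒StrictlyBelow : (x r : Path k) (a : Fin k) →
    StrictlyBelow (x ∷ʳ a) r → StrictlyBelow x r
  StrictlyBelow-∷ʳ⇒StrictlyBelow x r a (b , t , eq) = a , b ∷ t , trans eq (++-assoc x (a ∷ []) (b ∷ t))

  StrictlyBelow-irrefl : (x : Path k) → ¬ StrictlyBelow x x
  StrictlyBelow-irrefl x (b , t , e) = <-irrefl (cong length e)
    (subst (length x <_) (sym (length-++ x)) (m<m+n (length x) (s≤s z≤n)))

  isChild? : (y v : Path k) → Dec (IsChild y v)
  isChild? y v with List.initLast v
  ... | [] = no λ (a , e) → 0≢1+n (trans (cong length e) (length-∷ʳ y a))
  ... | u ∷ʳ′ b with ≡-dec Fin._≟_ u y
  ...   | yes refl = yes (b , refl)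
  ...   | no u≢y = no λ (a , e) → u≢y (proj₁ (∷ʳ-injective u y e))

module Obstruction {k : ℕ} (c : Config k) (s : Path k) where

  unobstructed-≡true : (i : Fin k) →
    (∀ j → j ≢ i → onPath (lookup c i) (lookup c j) s ≡ true →
       lookup c j ≡ lookup c i × toℕ i < toℕ j) →
    unobstructed c s i ≡ true
  unobstructed-≡true i blockers-follow = all-≡true _ (allFin k) harmless
    where
    harmless : ∀ j → (isYes (j Fin.≟ i) ∨ not (onPath (lookup c i) (lookup c j) s)
                      ∨ ((lookup c j ==ₚ lookup c i) ∧ (toℕ i <ᵇ toℕ j))) ≡ true
    harmless j with j Fin.≟ i | onPath (lookup c i) (lookup c j) s in on
    ... | yes _ | _ = refl
    ... | no _ | false = refl
    ... | no j≢i | true with blockers-follow j j≢i on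
    ... | same , i<j rewrite same | ==ₚ-refl (lookup c i) = <⇒<ᵇ≡true i<j

  unobstructed-≡false : (i j : Fin k) → j ≢ i → onPath (lookup c i) (lookup c j) s ≡ true →
    lookup c j ≢ lookup c i ⊎ toℕ j ≤ toℕ i → unobstructed c s i ≡ false
  unobstructed-≡false i j j≢i on blocks = all-≡false _ (allFin k) (∈-allFin j) blocking
    where
    precedes-false : lookup c j ≢ lookup c i ⊎ toℕ j ≤ toℕ i →
                     ((lookup c j ==ₚ lookup c i) ∧ (toℕ i <ᵇ toℕ j)) ≡ false
    precedes-false (inj₁ elsewhere) rewrite ==ₚ-≢ elsewhere = refl
    precedes-false (inj₂ j≤i) rewrite ≥⇒<ᵇ≡false j≤i = ∧-zeroʳ _
    blocking : (isYes (j Fin.≟ i) ∨ not (onPath (lookup c i) (lookup c j) s)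
                ∨ ((lookup c j ==ₚ lookup c i) ∧ (toℕ i <ᵇ toℕ j))) ≡ false
    blocking rewrite isYes-≡false (j Fin.≟ i) j≢i | on = precedes-false blocks

module Convergence {k : ℕ} (c : Config k) (x : Path k) (a : Fin k) (Z R : List (Path k))
  (Z-unique : Unique Z) (Z-children : All (IsChild (x ∷ʳ a)) Z)
  (c↭ : toList c ↭ Z ++ x ∷ R) (R-outside : All (λ r → ¬ StrictlyBelow x r) R) where

  y : Path k
  y = x ∷ʳ a

  open Obstruction c y

  child∉x∷R : ∀ {v} → IsChild y v → v ∉ x ∷ R
  child∉x∷R y◁v (here refl) = StrictlyBelow-irrefl x (grandchild⇒StrictlyBelow x _ a y◁v)
  child∉x∷R y◁v (there v∈R) = All.lookup R-outside v∈R (grandchild⇒StrictlyBelow x _ a y◁v)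

  server∈ : ∀ i → lookup c i ∈ Z ++ x ∷ R
  server∈ i = ∈-resp-↭ c↭ (∈-toList⁺ (∈-lookup i c))

  classify : ∀ i → IsChild y (lookup c i) ⊎ ¬ StrictlyBelow x (lookup c i)
  classify i with ∈-++⁻ Z (server∈ i)
  ... | inj₁ ∈Z = inj₁ (All.lookup Z-children ∈Z)
  ... | inj₂ (here refl) = inj₂ (StrictlyBelow-irrefl x)
  ... | inj₂ (there ∈R) = inj₂ (All.lookup R-outside ∈R)

  y-unoccupied : ∀ i → lookup c i ≢ y
  y-unoccupied i ci≡y with classify i
  ... | inj₁ (b , ci≡yb) = <-irrefl (cong length (trans (sym ci≡y) ci≡yb))
                             (subst (length y <_) (sym (length-∷ʳ y b)) (n<1+n (length y)))
  ... | inj₂ outside = outside (subst (StrictlyBelow x) (sym ci≡y) (StrictlyBelow-∷ʳ x a))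

  child-server-alone : ∀ i j → IsChild y (lookup c i) → lookup c j ≡ lookup c i → j ≡ i
  child-server-alone i j y◁ci cj≡ci with j Fin.≟ i
  ... | yes j≡i = j≡i
  ... | no j≢i = ⊥-elim (no-repeat-in-Unique Z-unique (child∉x∷R y◁ci)
                   (subst (_∈ others c i) cj≡ci (lookup∈others c j≢i))
                   (↭-trans (↭-sym (toList↭lookup∷others c i)) c↭))

  least-at-x : ∃[ i ] (lookup c i ≡ x × ∀ j → lookup c j ≡ x → toℕ i ≤ toℕ j)
  least-at-x = least-index (≡-dec Fin._≟_) c (∈-resp-↭ (↭-sym c↭) (∈-++⁺ʳ Z (here refl)))

  i₀ : Fin k
  i₀ = proj₁ least-at-x

  ci₀≡x : lookup c i₀ ≡ x
  ci₀≡x = proj₁ (proj₂ least-at-x)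

  i₀-least : ∀ j → lookup c j ≡ x → toℕ i₀ ≤ toℕ j
  i₀-least = proj₂ (proj₂ least-at-x)

  child≢i₀ : ∀ i → IsChild y (lookup c i) → i ≢ i₀
  child≢i₀ i y◁ci refl =
    StrictlyBelow-irrefl x (subst (StrictlyBelow x) ci₀≡x (grandchild⇒StrictlyBelow x _ a y◁ci))

  ≢x⇒≢i₀ : ∀ i → lookup c i ≢ x → i ≢ i₀
  ≢x⇒≢i₀ i ci≢x refl = ci≢x ci₀≡x

  unobstructed-child : ∀ i → IsChild y (lookup c i) → unobstructed c y i ≡ true
  unobstructed-child i y◁ci@(b , ci≡yb) = unobstructed-≡true i λ j j≢i on →
    case onPath-adjacent (lookup c i) (lookup c j) y
           (trans (cong (λ v → dist v y) ci≡yb) (dist-parent y b)) on of λ where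
      (inj₁ cj≡ci) → ⊥-elim (j≢i (child-server-alone i j y◁ci cj≡ci))
      (inj₂ cj≡y) → ⊥-elim (y-unoccupied j cj≡y)

  unobstructed-i₀ : unobstructed c y i₀ ≡ true
  unobstructed-i₀ = unobstructed-≡true i₀ λ j j≢i₀ on →
    case onPath-adjacent (lookup c i₀) (lookup c j) y
           (trans (cong (λ v → dist v y) ci₀≡x) (dist-child x a)) on of λ where
      (inj₁ cj≡ci₀) →
        cj≡ci₀ , ≤∧≢⇒< (i₀-least j (trans cj≡ci₀ ci₀≡x)) (j≢i₀ ∘ sym ∘ toℕ-injective)
      (inj₂ cj≡y) → ⊥-elim (y-unoccupied j cj≡y)

  obstructed-at-x : ∀ i → lookup c i ≡ x → i ≢ i₀ → unobstructed c y i ≡ false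
  obstructed-at-x i ci≡x i≢i₀ = unobstructed-≡false i i₀ (i≢i₀ ∘ sym)
    (subst₂ (λ u v → onPath u v y ≡ true) (sym ci≡x) (sym ci₀≡x) (onPath-self x y))
    (inj₂ (i₀-least i ci≡x))

  obstructed-outside : ∀ i → ¬ StrictlyBelow x (lookup c i) → lookup c i ≢ x → unobstructed c y i ≡ false
  obstructed-outside i outside ci≢x = unobstructed-≡false i i₀ (≢x⇒≢i₀ i ci≢x ∘ sym)
    (subst (λ v → onPath (lookup c i) v y ≡ true) (sym ci₀≡x) (onPath-parent x (lookup c i) a outside))
    (inj₁ λ ci₀≡ci → ci≢x (trans (sym ci₀≡ci) ci₀≡x))

  isChildᵇ : Path k → Bool
  isChildᵇ v = isYes (isChild? y v)

  isChildᵇ-outside : ∀ {v} → ¬ StrictlyBelow x v → isChildᵇ v ≡ false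
  isChildᵇ-outside outside = isYes-≡false (isChild? y _) (outside ∘ grandchild⇒StrictlyBelow x _ a)

  movers : ∀ i →
    iverson (unobstructed c y i) ≡ iverson (isChildᵇ (lookup c i)) + iverson (isYes (i Fin.≟ i₀))
  movers i with classify i
  ... | inj₁ y◁ci rewrite unobstructed-child i y◁ci | isYes-≡true (isChild? y (lookup c i)) y◁ci
                        | isYes-≡false (i Fin.≟ i₀) (child≢i₀ i y◁ci) = refl
  ... | inj₂ outside with ≡-dec Fin._≟_ (lookup c i) x
  ...   | no ci≢x rewrite obstructed-outside i outside ci≢x | isChildᵇ-outside outside
                        | isYes-≡false (i Fin.≟ i₀) (≢x⇒≢i₀ i ci≢x) = refl
  ...   | yes ci≡x with i Fin.≟ i₀
  ...     | yes refl rewrite unobstructed-i₀ | isChildᵇ-outside outside = refl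
  ...     | no i≢i₀ rewrite obstructed-at-x i ci≡x i≢i₀ | isChildᵇ-outside outside = refl

  dcStepCost≡ : dcStepCost c y ≡ suc (length Z)
  dcStepCost≡ = begin
    dcStepCost c y
      ≡⟨ cong sum (map-tabulate id (iverson ∘ unobstructed c y)) ⟩
    sum (List.tabulate (iverson ∘ unobstructed c y))
      ≡⟨ cong sum (tabulate-cong movers) ⟩
    sum (List.tabulate (λ i → iverson (isChildᵇ (lookup c i)) + iverson (isYes (i Fin.≟ i₀))))
      ≡⟨ sum-tabulate-+ (iverson ∘ isChildᵇ ∘ lookup c) (λ i → iverson (isYes (i Fin.≟ i₀))) ⟩
    sum (List.tabulate (iverson ∘ isChildᵇ ∘ lookup c))
      + sum (List.tabulate (λ i → iverson (isYes (i Fin.≟ i₀))))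
      ≡⟨ cong₂ _+_ (sum-tabulate-lookup (iverson ∘ isChildᵇ) c) (sum-tabulate-≟ i₀) ⟩
    sum (List.map (iverson ∘ isChildᵇ) (toList c)) + 1
      ≡⟨ cong (_+ 1) (sum-↭ (map⁺ (iverson ∘ isChildᵇ) c↭)) ⟩
    sum (List.map (iverson ∘ isChildᵇ) (Z ++ x ∷ R)) + 1
      ≡⟨ cong (_+ 1) (trans (cong sum (map-++ (iverson ∘ isChildᵇ) Z (x ∷ R)))
                            (sum-++ (List.map (iverson ∘ isChildᵇ) Z) _)) ⟩
    sum (List.map (iverson ∘ isChildᵇ) Z) + sum (List.map (iverson ∘ isChildᵇ) (x ∷ R)) + 1
      ≡⟨ cong₂ (λ m n → m + n + 1) (sum-map-All-≡ _ Z-counted) (sum-map-All-≡ _ x∷R-uncounted) ⟩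
    length Z * 1 + length (x ∷ R) * 0 + 1
      ≡⟨ cong₂ (λ m n → m + n + 1) (*-identityʳ (length Z)) (*-zeroʳ (length (x ∷ R))) ⟩
    length Z + 0 + 1
      ≡⟨ trans (cong (_+ 1) (+-identityʳ (length Z))) (+-comm (length Z) 1) ⟩
    suc (length Z) ∎
    where
    open ≡-Reasoning
    Z-counted : All (λ v → iverson (isChildᵇ v) ≡ 1) Z
    Z-counted = All.map (cong iverson ∘ isYes-≡true (isChild? y _)) Z-children
    x∷R-uncounted : All (λ v → iverson (isChildᵇ v) ≡ 0) (x ∷ R)
    x∷R-uncounted = cong iverson (isChildᵇ-outside (StrictlyBelow-irrefl x))
                  ∷ All.map (cong iverson ∘ isChildᵇ-outside) R-outside

  -- One step towards y moves server i₀ from x to y and every server on a child of y up to y.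
  raise : Path k → Path k
  raise v = if isChildᵇ v then y else v

  raise-y : raise y ≡ y
  raise-y with isChildᵇ y
  ... | true = refl
  ... | false = refl

  c′ : Config k
  c′ = c [ i₀ ]≔ y

  step-pointwise : ∀ i →
    (if unobstructed c y i then stepToward (lookup c i) y else lookup c i) ≡ raise (lookup c′ i)
  step-pointwise i with classify i
  ... | inj₁ y◁ci@(b , ci≡yb) rewrite unobstructed-child i y◁ci | lookup∘update′ (child≢i₀ i y◁ci) c y
                                    | isYes-≡true (isChild? y (lookup c i)) y◁ci | ci≡yb = stepToward-parent y b
  ... | inj₂ outside with ≡-dec Fin._≟_ (lookup c i) x
  ...   | no ci≢x rewrite obstructed-outside i outside ci≢x | lookup∘update′ (≢x⇒≢i₀ i ci≢x) c y
                        | isChildᵇ-outside outside = refl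
  ...   | yes ci≡x with i Fin.≟ i₀
  ...     | yes refl rewrite unobstructed-i₀ | lookup∘update i₀ c y | raise-y | ci₀≡x = stepToward-child x a
  ...     | no i≢i₀ rewrite obstructed-at-x i ci≡x i≢i₀ | lookup∘update′ i≢i₀ c y
                        | isChildᵇ-outside outside = refl

  dcStepConfig≡ : dcStepConfig c y ≡ Vec.map raise c′
  dcStepConfig≡ = begin
    dcStepConfig c y                   ≡⟨ Vec.tabulate-cong step-pointwise ⟩
    Vec.tabulate (raise ∘ lookup c′)   ≡⟨ tabulate-∘ raise (lookup c′) ⟩
    Vec.map raise (Vec.tabulate (lookup c′)) ≡⟨ cong (Vec.map raise) (tabulate∘lookup c′) ⟩
    Vec.map raise c′ ∎
    where open ≡-Reasoning

  c₁ : Config k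
  c₁ = dcStepConfig c y

  c₁-at-i₀ : lookup c₁ i₀ ≡ y
  c₁-at-i₀ = begin
    lookup c₁ i₀ ≡⟨ cong (λ c″ → lookup c″ i₀) dcStepConfig≡ ⟩
    lookup (Vec.map raise c′) i₀ ≡⟨ lookup-map i₀ raise c′ ⟩
    raise (lookup c′ i₀) ≡⟨ cong raise (lookup∘update i₀ c y) ⟩
    raise y ≡⟨ raise-y ⟩
    y ∎
    where open ≡-Reasoning

  c₁↭ : toList c₁ ↭ y ∷ replicate (length Z) y ++ R
  c₁↭ = begin
    toList c₁ ≡⟨ cong toList dcStepConfig≡ ⟩
    toList (Vec.map raise c′) ≡⟨ toList-map raise c′ ⟩
    List.map raise (toList c′) ↭⟨ map⁺ raise (toList-[]≔↭ c i₀ y c↭x∷) ⟩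
    raise y ∷ List.map raise (Z ++ R) ≡⟨ cong₂ _∷_ raise-y (map-++ raise Z R) ⟩
    y ∷ List.map raise Z ++ List.map raise R
      ≡⟨ cong₂ (λ u v → y ∷ u ++ v) (map-All-≡-replicate Z-raised) (map-id-local R-fixed) ⟩
    y ∷ replicate (length Z) y ++ R ∎
    where
    open PermutationReasoning
    c↭x∷ : toList c ↭ lookup c i₀ ∷ Z ++ R
    c↭x∷ = subst (λ v → toList c ↭ v ∷ Z ++ R) (sym ci₀≡x) (↭-trans c↭ (shift x Z R))
    Z-raised : All (λ v → raise v ≡ y) Z
    Z-raised = All.map (λ y◁v → cong (if_then y else _) (isYes-≡true (isChild? y _) y◁v)) Z-children
    R-fixed : All (λ v → raise v ≡ v) R
    R-fixed = All.map (λ outside → cong (if_then y else _) (isChildᵇ-outside outside)) R-outside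

  dcServe-converges : DCServe c (y , y) c₁ (suc (length Z)) × toList c₁ ↭ y ∷ replicate (length Z) y ++ R
  dcServe-converges =
    (c₁ , subst (DCBring c y c₁) (trans (+-identityʳ _) dcStepCost≡)
            (step unoccupied (here (i₀ , c₁-at-i₀))) ,
     i₀ , c₁-at-i₀ , sym (trans (cong (c₁ [ i₀ ]≔_) (sym c₁-at-i₀)) ([]≔-lookup c₁ i₀))) ,
    c₁↭
    where
    unoccupied : ¬ Occupied c y
    unoccupied (i , ci≡y) = y-unoccupied i ci≡y

open +-*-Solver using (solve; _:+_; con; _:=_)

matchCost : ℕ → ℕ → ℕ
matchCost j h = 2 * ((j + h) C h) ∸ 1

childrenCost : ℕ → ℕ → ℕ → ℕ
childrenCost h e zero = 0
childrenCost h e (suc n) = matchCost (suc e) h + childrenCost h (suc e) n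

C-positive : ∀ m r → r ≤ m → 1 ≤ m C r
C-positive m zero _ = ≤-refl
C-positive (suc m) (suc r) (s≤s r≤m) rewrite sym (nCk+nC[k+1]≡[n+1]C[k+1] m r) =
  ≤-trans (C-positive m r r≤m) (m≤m+n (m C r) (m C suc r))

suc-matchCost : ∀ j h → suc (matchCost j h) ≡ 2 * ((j + h) C h)
suc-matchCost j h = trans (+-comm 1 (matchCost j h))
  (m∸n+n≡m (≤-trans (C-positive (j + h) h (m≤n+m h j)) (m≤m+n _ _)))

matchCost-pascal : ∀ e h →
  suc (matchCost (suc e) (suc h)) ≡ suc (matchCost (suc e) h) + suc (matchCost e (suc h))
matchCost-pascal e h = begin
  suc (matchCost (suc e) (suc h))
    ≡⟨ suc-matchCost (suc e) (suc h) ⟩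
  2 * ((suc e + suc h) C suc h)
    ≡⟨ cong (λ n → 2 * (n C suc h)) (+-suc (suc e) h) ⟩
  2 * (suc (suc e + h) C suc h)
    ≡⟨ cong (2 *_) (sym (nCk+nC[k+1]≡[n+1]C[k+1] (suc e + h) h)) ⟩
  2 * ((suc e + h) C h + (suc e + h) C suc h)
    ≡⟨ *-distribˡ-+ 2 ((suc e + h) C h) _ ⟩
  2 * ((suc e + h) C h) + 2 * ((suc e + h) C suc h)
    ≡⟨ cong (λ n → 2 * ((suc e + h) C h) + 2 * (n C suc h)) (sym (+-suc e h)) ⟩
  2 * ((suc e + h) C h) + 2 * ((e + suc h) C suc h)
    ≡⟨ sym (cong₂ _+_ (suc-matchCost (suc e) h) (suc-matchCost e (suc h))) ⟩
  suc (matchCost (suc e) h) + suc (matchCost e (suc h)) ∎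
  where open ≡-Reasoning

childrenCost-telescopes : ∀ h e n →
  childrenCost h e n + n + suc (matchCost e (suc h)) ≡ suc (matchCost (e + n) (suc h))
childrenCost-telescopes h e zero = cong (λ m → suc (matchCost m (suc h))) (sym (+-identityʳ e))
childrenCost-telescopes h e (suc n) = begin
  matchCost (suc e) h + childrenCost h (suc e) n + suc n + suc (matchCost e (suc h))
    ≡⟨ regroup (matchCost (suc e) h) (childrenCost h (suc e) n) n (matchCost e (suc h)) ⟩
  childrenCost h (suc e) n + n + (suc (matchCost (suc e) h) + suc (matchCost e (suc h)))
    ≡⟨ cong (childrenCost h (suc e) n + n +_) (sym (matchCost-pascal e h)) ⟩
  childrenCost h (suc e) n + n + suc (matchCost (suc e) (suc h))
    ≡⟨ childrenCost-telescopes h (suc e) n ⟩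
  suc (matchCost (suc e + n) (suc h))
    ≡⟨ cong (λ m → suc (matchCost m (suc h))) (sym (+-suc e n)) ⟩
  suc (matchCost (e + suc n) (suc h)) ∎
  where
  open ≡-Reasoning
  regroup : ∀ m c n b → m + c + suc n + suc b ≡ c + n + (suc m + suc b)
  regroup = solve 4 (λ m c n b → m :+ c :+ (con 1 :+ n) :+ (con 1 :+ b)
                                := c :+ n :+ ((con 1 :+ m) :+ (con 1 :+ b))) refl

matchCost-suc : ∀ j h → suc j + childrenCost h 0 j ≡ matchCost j (suc h)
matchCost-suc j h = suc-injective (begin
  suc (suc j + childrenCost h 0 j)
    ≡⟨ regroup j (childrenCost h 0 j) ⟩
  childrenCost h 0 j + j + 2
    ≡⟨ cong (λ m → childrenCost h 0 j + j + suc (2 * m ∸ 1)) (sym (nCn≡1 (suc h))) ⟩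
  childrenCost h 0 j + j + suc (matchCost 0 (suc h))
    ≡⟨ childrenCost-telescopes h 0 j ⟩
  suc (matchCost j (suc h)) ∎)
  where
  open ≡-Reasoning
  regroup : ∀ j c → suc (suc j + c) ≡ c + j + 2
  regroup = solve 2 (λ j c → con 1 :+ (con 1 :+ j :+ c) := c :+ j :+ con 2) refl

module Reachability {k : ℕ} (d : ℕ) where

  Reaches : Config k → Config k → ℕ → (Config k → Config k → Set) → Set
  Reaches on off m P = ∃[ rs ] (All (ValidRequest k d) rs
    × ∃[ on' ] ∃[ off' ] (Run on off rs on' off' m 0 × P on' off'))

  run-++ : ∀ {on off : Config k} {rs on' off' m m' rs' on'' off'' n n'} →
    Run on off rs on' off' m m' → Run on' off' rs' on'' off'' n n' →
    Run on off (rs ++ rs') on'' off'' (m + n) (m' + n')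
  run-++ done run′ = run′
  run-++ (serve {m₁ = m₁} {m₁' = m₁'} {m = m} {m' = m'} dc offline run) run′ =
    subst₂ (Run _ _ _ _ _) (sym (+-assoc m₁ m _)) (sym (+-assoc m₁' m' _))
      (serve dc offline (run-++ run run′))

  reaches-done : ∀ {on off} {P : Config k → Config k → Set} → P on off → Reaches on off 0 P
  reaches-done p = [] , [] , _ , _ , done , p

  reaches-serve : ∀ {on off on₁ off₁ r m n} {P : Config k → Config k → Set} →
    ValidRequest k d r → DCServe on r on₁ m → OffServe off r off₁ 0 → Reaches on₁ off₁ n P →
    Reaches on off (m + n) P
  reaches-serve r-valid dc offline (rs , rs-valid , on' , off' , run , p) =
    _ ∷ rs , r-valid ∷ rs-valid , on' , off' , serve dc offline run , p

  reaches-then : ∀ {on off m n} {P Q : Config k → Config k → Set} →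
    Reaches on off m P → (∀ {on' off'} → P on' off' → Reaches on' off' n Q) → Reaches on off (m + n) Q
  reaches-then (rs , rs-valid , on' , off' , run , p) continue with continue p
  ... | rs′ , rs′-valid , on'' , off'' , run′ , q =
    rs ++ rs′ , ++⁺ rs-valid rs′-valid , on'' , off'' , run-++ run run′ , q

  reaches-cost : ∀ {on off m n} {P : Config k → Config k → Set} →
    m ≡ n → Reaches on off m P → Reaches on off n P
  reaches-cost refl r = r

  reaches-map : ∀ {on off m} {P Q : Config k → Config k → Set} →
    (∀ {on' off'} → P on' off' → Q on' off') → Reaches on off m P → Reaches on off m Q
  reaches-map f (rs , rs-valid , on' , off' , run , p) = rs , rs-valid , on' , off' , run , f p

  moveCost-refl : ∀ {n} (c : Vec (Path k) n) → Vec.sum (Vec.zipWith dist c c) ≡ 0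
  moveCost-refl Vec.[] = refl
  moveCost-refl (p Vec.∷ c) rewrite dist-refl p = moveCost-refl c

  serve-from-occupied : ∀ {on off : Config k} {i i' v} t → lookup on i ≡ v → lookup off i' ≡ v →
    DCServe on (v , t) (on [ i ]≔ t) 0 × OffServe off (v , t) (off [ i' ]≔ t) 0
  serve-from-occupied {off = off} t on-i off-i' =
    (_ , here (_ , on-i) , _ , on-i , refl) , (off , sym (moveCost-refl off) , _ , off-i' , refl)

  relocate-matched : ∀ {P T Q Q' : List (Path k)} {on off} → length P ≡ length T →
    All (ValidVertex k d) P → All (ValidVertex k d) T →
    toList on ↭ P ++ Q → toList off ↭ P ++ Q' →
    Reaches on off 0 (λ on' off' → toList on' ↭ T ++ Q × toList off' ↭ T ++ Q')
  relocate-matched {[]} {[]} _ _ _ on↭ off↭ = reaches-done (on↭ , off↭)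
  relocate-matched {p ∷ P} {t ∷ T} {Q} {Q'} {on} {off}
    |P|≡|T| (p-valid ∷ P-valid) (t-valid ∷ T-valid) on↭ off↭
    with toList-replace on on↭ | toList-replace off off↭
  ... | i , on-i , on-[i]≔ | i' , off-i' , off-[i']≔ =
    let dc , offline = serve-from-occupied t on-i off-i' in
    reaches-serve (p-valid , t-valid) dc offline
      (reaches-map (λ (on'↭ , off'↭) → ↭-trans on'↭ (shift t T Q) , ↭-trans off'↭ (shift t T Q'))
        (relocate-matched (suc-injective |P|≡|T|) P-valid T-valid
          (↭-trans (on-[i]≔ t) (↭-sym (shift t P Q)))
          (↭-trans (off-[i']≔ t) (↭-sym (shift t P Q')))))

module Transfer {k : ℕ} (d : ℕ) where
  open Reachability {k} d

  V : Path k → Set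
  V = ValidVertex k d

  TransferAt : ℕ → Set
  TransferAt h = ∀ {on off : Config k} {x : Path k} {a : Fin k} {M R R' : List (Path k)} →
    height d (x ∷ʳ a) ≡ h → V (x ∷ʳ a) → All V M →
    toList on ↭ M ++ x ∷ R → toList off ↭ M ++ (x ∷ʳ a) ∷ R' →
    All (λ r → ¬ StrictlyBelow x r) R →
    Reaches on off (matchCost (length M) h)
      (λ on' off' → toList on' ↭ M ++ (x ∷ʳ a) ∷ R × toList off' ↭ toList off)

  height-child : ∀ {h} (y : Path k) (b : Fin k) → height d y ≡ suc h → height d (y ∷ʳ b) ≡ h
  height-child {h} y b hy = begin
    d ∸ length (y ∷ʳ b) ≡⟨ cong (d ∸_) (length-∷ʳ y b) ⟩
    d ∸ suc (length y)  ≡⟨ sym (pred[m∸n]≡m∸[1+n] d (length y)) ⟩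
    pred (d ∸ length y) ≡⟨ cong pred hy ⟩
    h ∎
    where open ≡-Reasoning

  child-valid : ∀ {h} {y v : Path k} → height d y ≡ suc h → IsChild y v → V v
  child-valid {y = y} hy (b , refl) =
    subst (_≤ d) (sym (length-∷ʳ y b)) (m∸n≢0⇒n<m (λ d∸y≡0 → 0≢1+n (trans (sym d∸y≡0) hy)))

  offServe-idle : ∀ {off : Config k} {v} → v ∈ toList off → OffServe off (v , v) off 0
  offServe-idle {off} v∈off with ∈-toList⇒lookup off v∈off
  ... | i , off-i = off , sym (moveCost-refl off) , i , off-i ,
                    sym (trans (cong (off [ i ]≔_) (sym off-i)) ([]≔-lookup off i))

  -- D: the children already served; each offline server on Z still awaits an online one from y.
  serve-children : ∀ {h'} → TransferAt h' → ∀ {y : Path k} {R R' : List (Path k)} →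
    height d y ≡ suc h' → V y → All (λ r → ¬ StrictlyBelow y r) R →
    ∀ (Z D : List (Path k)) {on off} → All (IsChild y) Z → All V D →
    toList on ↭ D ++ y ∷ replicate (length Z) y ++ R → toList off ↭ Z ++ D ++ y ∷ R' →
    Reaches on off (childrenCost h' (length D) (length Z))
      (λ on' off' → toList on' ↭ Z ++ D ++ y ∷ R × toList off' ↭ Z ++ D ++ y ∷ R')
  serve-children IH hy y-valid R-outside [] D _ _ on↭ off↭ = reaches-done (on↭ , off↭)
  serve-children IH {y} {R} {R'} hy y-valid R-outside (z ∷ Z) D {on} {off}
    ((b , refl) ∷ Z-children) D-valid on↭ off↭ =
    reaches-then
      (IH (height-child y b hy) z-valid (y-valid ∷ D-valid)
          (↭-trans on↭ (shift y D (y ∷ replicate (length Z) y ++ R)))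
          off↭′
          (++⁺ (replicate⁺ (length Z) (StrictlyBelow-irrefl y)) R-outside))
      λ (on₁↭ , off₁↭) →
        reaches-map (λ (on'↭ , off'↭) → ↭-trans on'↭ (shift z Z _) , ↭-trans off'↭ (shift z Z _))
          (serve-children IH hy y-valid R-outside Z (z ∷ D) Z-children (z-valid ∷ D-valid)
            (↭-trans on₁↭ (swap-heads y z D))
            (↭-trans off₁↭ (↭-trans off↭ (↭-sym (shift z Z (D ++ y ∷ R'))))))
    where
    z-valid : V (y ∷ʳ b)
    z-valid = child-valid {y = y} hy (b , refl)
    swap-heads : ∀ u v (D : List (Path k)) {L} → u ∷ D ++ v ∷ L ↭ v ∷ D ++ u ∷ L
    swap-heads u v D {L} =
      ↭-trans (prep u (shift v D L)) (↭-trans (swap u v ↭-refl) (prep v (↭-sym (shift u D L))))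
    off↭′ : toList off ↭ (y ∷ D) ++ z ∷ Z ++ R'
    off↭′ = ↭-trans off↭ (↭-trans (shifts (z ∷ Z) D)
              (↭-trans (++⁺ˡ D (shift y (z ∷ Z) R')) (shift y D (z ∷ Z ++ R'))))

  parent-valid : ∀ (x : Path k) a → V (x ∷ʳ a) → V x
  parent-valid x a = ≤-trans (subst (length x ≤_) (sym (length-∷ʳ x a)) (n≤1+n (length x)))

  children : Path k → ℕ → List (Path k)
  children y j = List.map (y ∷ʳ_) (take j (allFin k))

  children-unique : ∀ y j → Unique (children y j)
  children-unique y j = Unique.map⁺ (proj₂ ∘ ∷ʳ-injective y y) (Unique.take⁺ j (Unique.allFin⁺ k))

  children-are-children : ∀ y j → All (IsChild y) (children y j)
  children-are-children y j = All.map⁺ (All.universal (λ b → b , refl) _)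

  length-children : ∀ y {j} → j ≤ k → length (children y j) ≡ j
  length-children y {j} j≤k = begin
    length (children y j) ≡⟨ length-map (y ∷ʳ_) (take j (allFin k)) ⟩
    length (take j (allFin k)) ≡⟨ length-take j (allFin k) ⟩
    j ⊓ length (allFin k) ≡⟨ cong (j ⊓_) (length-tabulate id) ⟩
    j ⊓ k ≡⟨ m≤n⇒m⊓n≡m j≤k ⟩
    j ∎
    where open ≡-Reasoning

  open Convergence using (dcServe-converges)

  transfer : ∀ h → TransferAt h
  transfer zero {on} {off} {x} {a} {M} {R} {R'} hy y-valid M-valid on↭ off↭ R-outside =
    reaches-then (relocate-matched (sym (length-replicate j)) M-valid (replicate⁺ j x-valid) on↭ off↭)
      λ {on₁} (on₁↭ , off₁↭) →
        let dc , on₂↭ = dcServe-converges on₁ x a [] (replicate j x ++ R) [] []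
                          (↭-trans on₁↭ (shift x (replicate j x) R))
                          (++⁺ (replicate⁺ j (StrictlyBelow-irrefl x)) R-outside)
        in reaches-serve (y-valid , y-valid) dc
             (offServe-idle (∈-resp-↭ (↭-sym off₁↭) (∈-++⁺ʳ _ (here refl))))
             (reaches-map (λ (on'↭ , off'↭) → on'↭ , ↭-trans off'↭ (↭-sym off↭))
               (relocate-matched (length-replicate j) (replicate⁺ j x-valid) M-valid
                 (↭-trans on₂↭ (↭-sym (shift (x ∷ʳ a) (replicate j x) R))) off₁↭))
    where
    j : ℕ
    j = length M
    x-valid : V x
    x-valid = parent-valid x a y-valid
  transfer (suc h) {on} {off} {x} {a} {M} {R} {R'} hy y-valid M-valid on↭ off↭ R-outside =
    reaches-cost cost≡ $
    reaches-then (relocate-matched (sym |Z|≡j) M-valid Z-valid on↭ off↭)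
      λ {on₁} (on₁↭ , off₁↭) →
        let dc , on₂↭ = dcServe-converges on₁ x a Z R (children-unique y j) Z-children on₁↭ R-outside
        in reaches-serve (y-valid , y-valid) dc
             (offServe-idle (∈-resp-↭ (↭-sym off₁↭) (∈-++⁺ʳ Z (here refl)))) $
           reaches-then (serve-children (transfer h) hy y-valid R-outside-y Z [] Z-children [] on₂↭ off₁↭)
             λ (on₃↭ , off₃↭) →
               reaches-map (λ (on'↭ , off'↭) → on'↭ , ↭-trans off'↭ (↭-sym off↭))
                 (relocate-matched |Z|≡j Z-valid M-valid on₃↭ off₃↭)
    where
    y : Path k
    y = x ∷ʳ a
    j : ℕ
    j = length M
    Z : List (Path k)
    Z = children y j
    j<k : j < k
    j<k = subst (j <_) (trans (sym (trans (↭-length on↭) (length-++ M))) (length-toList on))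
            (m<m+n j (s≤s z≤n))
    |Z|≡j : length Z ≡ j
    |Z|≡j = length-children y (<⇒≤ j<k)
    Z-children : All (IsChild y) Z
    Z-children = children-are-children y j
    Z-valid : All V Z
    Z-valid = All.map (child-valid hy) Z-children
    R-outside-y : All (λ r → ¬ StrictlyBelow y r) R
    R-outside-y = All.map (λ outside → outside ∘ StrictlyBelow-∷ʳ⇒StrictlyBelow x _ a) R-outside
    cost≡ : 0 + (suc (length Z) + (childrenCost h 0 (length Z) + 0)) ≡ matchCost j (suc h)
    cost≡ = trans (cong (λ n → suc n + (childrenCost h 0 n + 0)) |Z|≡j)
                  (trans (cong (suc j +_) (+-identityʳ _)) (matchCost-suc j h))

JMatch-view : ∀ {k j} {x y : Path k} {on off : Config k} → JMatch j x y on off →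
  ∃[ M ] ∃[ L ] ∃[ L' ] (length M ≡ j × toList on ↭ M ++ x ∷ L × toList off ↭ M ++ y ∷ L'
                        × All (λ r → ¬ StrictlyBelow x r) L)
JMatch-view {x = x} {y} (M , Ron , Roff , |M|≡j , on↭ , off↭ , x∈Ron , Ron-outside , y∈Roff)
  with ∈-∃++ x∈Ron | ∈-∃++ y∈Roff
... | A , B , refl | U , W , refl =
  M , A ++ B , U ++ W , |M|≡j ,
  ↭-trans on↭ (++⁺ˡ M (shift x A B)) , ↭-trans off↭ (++⁺ˡ M (shift y U W)) ,
  ++⁺ (All.++⁻ˡ A Ron-outside) (All.tail (All.++⁻ʳ A Ron-outside))

open Reachability using (reaches-cost; reaches-map)
open Transfer using (transfer)

lemma14 : (k d j : ℕ) (on off : Config k) (x y : Path k) →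
    ValidConfig k d on → ValidConfig k d off → ValidVertex k d x → ValidVertex k d y →
    IsChild x y → JMatch j x y on off →
    ∃[ rs ] (All (ValidRequest k d) rs
      × ∃[ on' ] ∃[ off' ]
          ( Run on off rs on' off' (2 * ((j + height d y) C height d y) ∸ 1) 0
          × (∃[ i ] (lookup on i ≡ x × toList on' ↭ toList (on [ i ]≔ y)))
          × toList off' ↭ toList off ))
lemma14 k d j on off x _ on-valid _ _ y-valid (a , refl) match with JMatch-view match
... | M , L , L' , |M|≡j , on↭ , off↭ , L-outside with toList-replace on (↭-trans on↭ (shift x M L))
... | i , on-i≡x , on-[i]≔ =
  reaches-cost d (cong (λ m → matchCost m (height d y)) |M|≡j) $
  reaches-map d (λ (on'↭ , off'↭) →
                  (i , on-i≡x , ↭-trans on'↭ (↭-trans (shift y M L) (↭-sym (on-[i]≔ y)))) , off'↭)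
    (transfer d (height d y) refl y-valid M-valid on↭ off↭ L-outside)
  where
  y : Path k
  y = x ∷ʳ a
  M-valid : All (ValidVertex k d) M
  M-valid = All.++⁻ˡ M (All-resp-↭ on↭ (VAll.toList⁺ on-valid))
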